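{- Let $\mathcal G=(V,E,\lambda)$ be a simple temporal graph and $S\subseteq V$. Run the Foremost Forest algorithm on $(\mathcal G,S)$ and let $k$ be the final value of its counter and $\mathcal G_F^k$ its output. Then (i) $\mathcal G_F^k$ is a foremost forest for $S$ in $\mathcal G$, and (ii) the labels of the added edges satisfy $\lambda(e_{|S|})\le\lambda(e_{|S|+1})\le\dots\le\lambda(e_k)$.
   Context: A simple temporal graph $\mathcal G=(V,E,\lambda)$ is a finite simple graph $(V,E)$ with a label $\lambda(e)\in\mathbb R$ for each edge. A temporal subgraph of $\mathcal G$ is $(V',E',\lambda|_{E'})$ with $V'\subseteq V$, $E'\subseteq E$. A temporal $(u,v)$-path is a vertex sequence $u=u_0,\dots,u_\ell=v$ with $e_i=\{u_{i-1},u_i\}\in E$ and $\lambda(e_1)<\dots<\lambda(e_\ell)$; its arrival time is $\lambda(e_\ell)$; every vertex reaches itself. For $S\subseteq V$, a foremost $(S,v)$-path is a temporal $(u,v)$-path, $u\in S$, of earliest arrival time among all such paths over all $u\in S$. An increasing temporal forest for $S$ is a temporal subgraph $\mathcal G_F=(V_F,E_F,\lambda_F)$ of $\mathcal G$ such that $(V_F,E_F)$ is a forest with exactly $|S|$ components and for each $s\in S$ there is a component $T_s$ all of whose vertices are reached by $s$ in $\mathcal G_F$. It is a partial foremost forest for $S$ if for every $v\in V_F\setminus S$ the unique temporal $(S,v)$-path in $\mathcal G_F$ is a foremost $(S,v)$-path in $\mathcal G$; it is a foremost forest for $S$ if moreover $V_F$ equals the set of vertices reachable in $\mathcal G$ from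 some vertex of $S$. For an increasing temporal forest $\mathcal G_F$, $\mathcal G_F\cup e$ denotes adding edge $e$ (with its endpoints and label), and $\mathrm{ext}(\mathcal G_F)$ is the set of edges $e=\{u,v\}\in E$ with $u\in V_F$, $v\notin V_F$ such that $\mathcal G_F\cup e$ is an increasing temporal forest for $S$. The Foremost Forest algorithm: set $k=|S|-1$ and $\mathcal G_F^{k}=(S,\emptyset,\emptyset)$; while $\mathrm{ext}(\mathcal G_F^k)\neq\emptyset$: set $k:=k+1$, let $e_k$ be an edge of minimum label in $\mathrm{ext}(\mathcal G_F^{k-1})$, and set $\mathcal G_F^k:=\mathcal G_F^{k-1}\cup e_k$; return $\mathcal G_F^k$. -}

module Defs where

open import Level using (0ℓ)
open import Data.Nat using (ℕ; _≥_)
open import Data.Fin using (Fin)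
open import Data.Fin.Subset using (Subset; _∈_; _∉_; ∣_∣)
open import Data.Maybe using (Maybe; just; nothing)
open import Data.List using (List; []; _∷_; _++_; [_]; length)
open import Data.List.Relation.Unary.All using (All)
open import Data.List.Relation.Unary.AllPairs using (AllPairs)
open import Data.List.Relation.Unary.Linked using (Linked)
open import Data.List.Relation.Unary.Unique.Propositional using (Unique)
open import Data.List.Membership.Propositional using () renaming (_∈_ to _∈ₗ_)
open import Data.Product using (Σ; ∃; _×_; _,_; proj₁; proj₂)
open import Data.Sum using (_⊎_; inj₁; inj₂)
open import Data.Empty using (⊥)
open import Data.Unit using (⊤)
open import Relation.Nullary using (¬_)
open import Relation.Binary.Structures using (IsStrictTotalOrder)
open import Relation.Binary.PropositionalEquality using (_≡_; refl; sym; trans)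
open import Relation.Binary.Construct.Closure.ReflexiveTransitive using (Star)

-- Labels: an arbitrary strict total order (the paper uses ℝ; only the
-- order of labels is ever used).

record Labels : Set₁ where
  field
    L     : Set
    _<_   : L → L → Set
    isSTO : IsStrictTotalOrder _≡_ _<_

  _≤_ : L → L → Set
  a ≤ b = a < b ⊎ a ≡ b

-- Simple temporal graphs on vertex set Fin n.
-- adj u v ≡ just t  iff  {u,v} ∈ E with λ({u,v}) = t.

record TemporalGraph (O : Labels) (n : ℕ) : Set where
  open Labels O
  field
    adj    : Fin n → Fin n → Maybe L
    adjSym : ∀ u v → adj u v ≡ adj v u
    adjIrr : ∀ v → adj v v ≡ nothing

module _ {O : Labels} {n : ℕ} (G : TemporalGraph O n) where
  open Labels O
  open TemporalGraph G

  record Sub : Set₁ where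
    field
      inV    : Fin n → Set
      inE    : Fin n → Fin n → Set
      inESym : ∀ {u v} → inE u v → inE v u
      inEAdj : ∀ {u v} → inE u v → ∃ λ t → adj u v ≡ just t
      inEV   : ∀ {u v} → inE u v → inV u × inV v

  whole : Sub
  whole = record
    { inV    = λ _ → ⊤
    ; inE    = λ u v → ∃ λ t → adj u v ≡ just t
    ; inESym = λ { {u} {v} (t , p) → t , trans (sym (adjSym u v)) p }
    ; inEAdj = λ p → p
    ; inEV   = λ _ → _ , _
    }

  module _ (H : Sub) where
    open Sub H

    HasEdge : Fin n → Fin n → L → Set
    HasEdge u v t = inE u v × adj u v ≡ just t

    Before : Maybe L → L → Set
    Before nothing  _ = ⊤
    Before (just t) t' = t < t'

    -- TPath u v a : a temporal (u,v)-path (vertex sequence with strictly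
    -- increasing labels) in H, with arrival time a (nothing for the
    -- trivial path u = v of length 0).
    data TPath : Fin n → Fin n → Maybe L → Set where
      here : ∀ {u} → inV u → TPath u u nothing
      step : ∀ {u w v a t} → TPath u w a → HasEdge w v t → Before a t →
             TPath u v (just t)

    Reaches : Fin n → Fin n → Set
    Reaches u v = ∃ λ a → TPath u v a

    Adj : Fin n → Fin n → Set
    Adj u v = inE u v

    Connected : Fin n → Fin n → Set
    Connected u v = inV u × Star Adj u v

    record Cycle : Set where
      field
        vs      : List (Fin n)
        long    : length vs ≥ 3
        uniq    : Unique vs
        linked  : Linked Adj vs
        closing : ∃ λ x → ∃ λ y → ∃ λ zs → vs ≡ x ∷ zs × ∃ λ ws → zs ≡ ws ++ [ y ] × Adj y x

    IsForest : Set
    IsForest = ¬ Cycle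

    -- (V',E') has exactly c connected components: there is a system of
    -- c pairwise non-connected representatives covering V'.
    HasComponents : ℕ → Set
    HasComponents c = ∃ λ (reps : List (Fin n)) →
      length reps ≡ c × All inV reps × AllPairs (λ a b → ¬ Connected a b) reps ×
      (∀ v → inV v → ∃ λ r → r ∈ₗ reps × Connected r v)

  ArrLE : Maybe L → Maybe L → Set
  ArrLE nothing  _        = ⊤
  ArrLE (just _) nothing  = ⊥
  ArrLE (just a) (just b) = a ≤ b

  module _ (S : Subset n) where

    IsForemostArrival : Fin n → Maybe L → Set
    IsForemostArrival v a = ∀ u a' → u ∈ S → TPath whole u v a' → ArrLE a a'

    IsIncreasingTemporalForest : Sub → Set
    IsIncreasingTemporalForest H =
      IsForest H × HasComponents H ∣ S ∣ ×
      (∀ s → s ∈ S → ∃ λ r → Sub.inV H r × (∀ w → Connected H r w → Reaches H s w))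

    IsPartialForemostForest : Sub → Set
    IsPartialForemostForest H =
      IsIncreasingTemporalForest H ×
      (∀ v → Sub.inV H v → v ∉ S →
         ∀ u a → u ∈ S → TPath H u v a → IsForemostArrival v a)

    IsForemostForest : Sub → Set
    IsForemostForest H =
      IsPartialForemostForest H ×
      (∀ v → Sub.inV H v → ∃ λ s → s ∈ S × Reaches whole s v) ×
      (∀ v s → s ∈ S → Reaches whole s v → Sub.inV H v)

    initial : Sub
    initial = record
      { inV = λ v → v ∈ S ; inE = λ _ _ → ⊥
      ; inESym = λ () ; inEAdj = λ () ; inEV = λ () }

    addEdge : Sub → (u v : Fin n) (t : L) → adj u v ≡ just t → Sub
    addEdge H u v t p = record
      { inV    = λ w → Sub.inV H w ⊎ w ≡ u ⊎ w ≡ v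
      ; inE    = λ a b → Sub.inE H a b ⊎ (a ≡ u × b ≡ v) ⊎ (a ≡ v × b ≡ u)
      ; inESym = λ { (inj₁ e) → inj₁ (Sub.inESym H e)
                   ; (inj₂ (inj₁ (refl , refl))) → inj₂ (inj₂ (refl , refl))
                   ; (inj₂ (inj₂ (refl , refl))) → inj₂ (inj₁ (refl , refl)) }
      ; inEAdj = λ { (inj₁ e) → Sub.inEAdj H e
                   ; (inj₂ (inj₁ (refl , refl))) → t , p
                   ; (inj₂ (inj₂ (refl , refl))) → t , trans (adjSym v u) p }
      ; inEV   = λ { (inj₁ e) → inj₁ (proj₁ (Sub.inEV H e)) , inj₁ (proj₂ (Sub.inEV H e))
                   ; (inj₂ (inj₁ (refl , refl))) → inj₂ (inj₁ refl) , inj₂ (inj₂ refl)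
                   ; (inj₂ (inj₂ (refl , refl))) → inj₂ (inj₂ refl) , inj₂ (inj₁ refl) }
      }

    InExt : Sub → Fin n → Fin n → L → Set
    InExt H u v t = Sub.inV H u × ¬ Sub.inV H v ×
      Σ (adj u v ≡ just t) λ p → IsIncreasingTemporalForest (addEdge H u v t p)

    ExtEmpty : Sub → Set
    ExtEmpty H = ∀ u v t → ¬ InExt H u v t

    -- Run H ls : H = G_F^k is reachable by an execution of the Foremost
    -- Forest algorithm, and ls = [λ(e_|S|), …, λ(e_k)] are the labels of
    -- the added edges in order.
    data Run : Sub → List L → Set₁ where
      start : Run initial []
      add   : ∀ {H ls} → Run H ls → ∀ u v t → (e : InExt H u v t) →
              (∀ u' v' t' → InExt H u' v' t' → t ≤ t') →
              Run (addEdge H u v t (proj₁ (proj₂ (proj₂ e)))) (ls ++ [ t ])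

-- The algorithm maintains an invariant of G_F: it contains S, every vertex is reached from S,
-- all temporal paths from S to a vertex arrive at the same time, that time is foremost in G,
-- and G_F is an increasing temporal forest.  For u ∈ V_F and v ∉ V_F, the edge {u,v} lies in
-- ext(G_F) exactly when u is reached from S strictly before λ({u,v}): adding a pendant edge
-- never creates a cycle or merges components.  A temporal path of G from S to a vertex outside
-- G_F leaves G_F through an edge of ext(G_F) labelled at most its arrival time; hence adding an
-- edge of minimum label keeps all arrival times foremost, and once ext(G_F) is empty every vertex
-- reachable from S is in G_F.  An edge of ext after step k either was in ext before, or leaves
-- the vertex just added, which is reached at time λ(e_k); either way its label is ≥ λ(e_k), so
-- the labels are sorted.
module Submission where

open import Defs
open import Level using (0ℓ)
open import Function using (_∘_)
open import Data.Nat using (ℕ; suc; s≤s)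
open import Data.Bool using (true; false)
open import Data.Fin using (Fin; _≟_) renaming (zero to fzero; suc to fsuc)
open import Data.Fin.Properties using (suc-injective)
open import Data.Fin.Subset using (Subset; _∈_; _∉_; ∣_∣)
open import Data.Fin.Subset.Properties using () renaming (_∈?_ to _∈S?_)
open import Data.Vec using ([]; _∷_; here; there)
open import Data.Maybe using (Maybe; just; nothing)
open import Data.Maybe.Properties using (just-injective)
open import Data.List using (List; []; _∷_; _++_; [_]; length; map)
open import Data.List.Properties using (length-map)
open import Data.List.Relation.Unary.All as All using (All; []; _∷_)
open import Data.List.Relation.Unary.All.Properties using (map⁺; ∷ʳ⁺; ¬Any⇒All¬)
open import Data.List.Relation.Unary.Any using (here; there)
open import Data.List.Relation.Unary.AllPairs as AllPairs using (AllPairs; []; _∷_)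
open import Data.List.Relation.Unary.Linked using (Linked; []; [-]; _∷_)
open import Data.List.Relation.Unary.Unique.Propositional using (Unique)
import Data.List.Relation.Unary.Unique.Propositional.Properties as Unique
open import Data.List.Membership.Propositional using () renaming (_∈_ to _∈ₗ_)
open import Data.List.Membership.Propositional.Properties using (∈-map⁺; ∈-++⁺ʳ)
import Data.List.Membership.DecPropositional as DecMembership
open import Data.Product using (∃; _×_; _,_; proj₁; proj₂; map₂)
open import Data.Sum using (_⊎_; inj₁; inj₂)
open import Data.Empty using (⊥-elim)
open import Data.Unit using (⊤; tt)
open import Relation.Nullary using (¬_; Dec; yes; no)
open import Relation.Nullary.Decidable using (_⊎-dec_)
open import Relation.Binary.Core using (Rel)
open import Relation.Binary.Definitions using (Transitive; Trans)
open import Relation.Binary.Structures using (IsStrictTotalOrder)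
open import Relation.Binary.PropositionalEquality using (_≡_; _≢_; refl; sym; trans; cong; subst)
open import Relation.Binary.Construct.Closure.ReflexiveTransitive using (Star; ε; _◅_; _◅◅_; gmap; reverse)
import Relation.Binary.Construct.StrictToNonStrict as StrictToNonStrict

module _ {A : Set} where

  data Last (y : A) : List A → Set where
    last  : Last y [ y ]
    later : ∀ {x xs} → Last y xs → Last y (x ∷ xs)

  Last-++ : ∀ xs y → Last y (xs ++ [ y ])
  Last-++ []       y = last
  Last-++ (x ∷ xs) y = later (Last-++ xs y)

  Last-unique : ∀ {y z xs} → Last y xs → Last z xs → y ≡ z
  Last-unique last      last       = refl
  Last-unique last      (later ())
  Last-unique (later ()) last
  Last-unique (later l) (later l′) = Last-unique l l′

  Linked-∷ʳ : ∀ {R : Rel A 0ℓ} {xs x} → Linked R xs → All (λ y → R y x) xs →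
              Linked R (xs ++ [ x ])
  Linked-∷ʳ []       []             = [-]
  Linked-∷ʳ [-]      (r ∷ [])       = r ∷ [-]
  Linked-∷ʳ (r ∷ rs) (_ ∷ r′ ∷ r′s) = r ∷ Linked-∷ʳ rs (r′ ∷ r′s)

  module _ {P : A → Set} {R R′ : Rel A 0ℓ} (restrict : ∀ {a b} → P a → P b → R a b → R′ a b) where

    Linked-restrict : ∀ {xs} → All P xs → Linked R xs → Linked R′ xs
    Linked-restrict _              []       = []
    Linked-restrict _              [-]      = [-]
    Linked-restrict (pa ∷ pb ∷ ps) (r ∷ rs) = restrict pa pb r ∷ Linked-restrict (pb ∷ ps) rs

    AllPairs-restrict : ∀ {xs} → All P xs → AllPairs R xs → AllPairs R′ xs
    AllPairs-restrict []        []         = []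
    AllPairs-restrict (pa ∷ ps) (rs ∷ rss) = row ps rs ∷ AllPairs-restrict ps rss
      where
        row : ∀ {ys} → All P ys → All (R _) ys → All (R′ _) ys
        row []         []        = []
        row (pb ∷ pbs) (r ∷ rs′) = restrict pa pb r ∷ row pbs rs′

  module _ {R : Rel A 0ℓ} where

    predecessor : ∀ {a y xs} → Last y xs → Linked R (a ∷ xs) → ∃ λ p → p ∈ₗ a ∷ xs × R p y
    predecessor last      (r ∷ _)  = _ , here refl , r
    predecessor (later l) (_ ∷ rs) with predecessor l rs
    ... | p , p∈ , r = p , there p∈ , r

    -- A vertex whose only neighbour is u can occur in a chain without repetitions only at an
    -- end, since in the interior both of its (distinct) neighbours would be u.
    module _ {u v : A} (only-u : ∀ {a} → R a v → a ≡ u) (only-u′ : ∀ {a} → R v a → a ≡ u) where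

      Linked-end : ∀ {xs} → Linked R xs → Unique xs → v ∈ₗ xs → (∃ λ ys → xs ≡ v ∷ ys) ⊎ Last v xs
      Linked-end [-]      _        (here refl) = inj₁ (_ , refl)
      Linked-end (_ ∷ _)  _        (here refl) = inj₁ (_ , refl)
      Linked-end (_ ∷ rs) (_ ∷ uq) (there v∈) with Linked-end rs uq v∈
      ... | inj₂ l = inj₂ (later l)
      Linked-end (_ ∷ [-])    _                   (there _) | inj₁ (_ , refl) = inj₂ (later last)
      Linked-end (r ∷ r′ ∷ _) ((_ ∷ a≢c ∷ _) ∷ _) (there _) | inj₁ (_ , refl) =
        ⊥-elim (a≢c (trans (only-u r) (sym (only-u′ r′))))

record Enumeration {m : ℕ} (S : Subset m) : Set where
  field
    elements : List (Fin m)
    length≡  : length elements ≡ ∣ S ∣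
    sound    : All (_∈ S) elements
    unique   : Unique elements
    complete : ∀ {w} → w ∈ S → w ∈ₗ elements

enumerate : ∀ {m} (S : Subset m) → Enumeration S
enumerate [] = record
  { elements = [] ; length≡ = refl ; sound = [] ; unique = [] ; complete = λ () }
enumerate (true ∷ S) = record
  { elements = fzero ∷ map fsuc elements
  ; length≡  = cong suc (trans (length-map fsuc elements) length≡)
  ; sound    = here ∷ map⁺ (All.map there sound)
  ; unique   = map⁺ (All.universal (λ _ ()) elements) ∷ Unique.map⁺ suc-injective unique
  ; complete = λ { {fzero} _ → here refl ; {fsuc _} (there w∈) → there (∈-map⁺ fsuc (complete w∈)) }
  }
  where open Enumeration (enumerate S)
enumerate (false ∷ S) = record
  { elements = map fsuc elements
  ; length≡  = trans (length-map fsuc elements) length≡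
  ; sound    = map⁺ (All.map there sound)
  ; unique   = Unique.map⁺ suc-injective unique
  ; complete = λ { {fsuc _} (there w∈) → ∈-map⁺ fsuc (complete w∈) }
  }
  where open Enumeration (enumerate S)

module ForemostForest {O : Labels} {n : ℕ} (G : TemporalGraph O n) (S : Subset n) where
  open Labels O
  open TemporalGraph G
  open IsStrictTotalOrder isSTO
    using (isEquivalence; <-resp-≈; <-respˡ-≈) renaming (trans to <-trans; irrefl to <-irrefl)
  private module NonStrict = StrictToNonStrict {A = L} _≡_ _<_
  open DecMembership (_≟_ {n}) using () renaming (_∈?_ to _∈ₗ?_)

  ≤-trans : Transitive _≤_
  ≤-trans = NonStrict.trans isEquivalence <-resp-≈ <-trans

  ≤-<-trans : Trans _≤_ _<_ _<_
  ≤-<-trans = NonStrict.≤-<-trans sym <-trans <-respˡ-≈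

  -- Before G H without the dependence on H, so that it can be moved between subgraphs.
  ArrLT : Maybe L → L → Set
  ArrLT nothing  _ = ⊤
  ArrLT (just a) t = a < t

  Before⇒ArrLT : ∀ H a {t} → Before G H a t → ArrLT a t
  Before⇒ArrLT _ nothing  _   = tt
  Before⇒ArrLT _ (just _) a<t = a<t

  ArrLT⇒Before : ∀ H a {t} → ArrLT a t → Before G H a t
  ArrLT⇒Before _ nothing  _   = tt
  ArrLT⇒Before _ (just _) a<t = a<t

  ArrLE-ArrLT-trans : ∀ {a b t} → ArrLE G a b → ArrLT b t → ArrLT a t
  ArrLE-ArrLT-trans {nothing}                _    _   = tt
  ArrLE-ArrLT-trans {just _} {just _} a≤b b<t = ≤-<-trans a≤b b<t

  ≤-ArrLE-trans : ∀ {t t′ a} → t ≤ t′ → ArrLE G (just t′) a → ArrLE G (just t) a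
  ≤-ArrLE-trans {a = just _} t≤t′ t′≤a = ≤-trans t≤t′ t′≤a

  record _⊑_ (H H′ : Sub G) : Set where
    field
      V⊆ : ∀ {w} → Sub.inV H w → Sub.inV H′ w
      E⊆ : ∀ {a b} → Sub.inE H a b → Sub.inE H′ a b
  open _⊑_

  ⊑-whole : ∀ {H} → H ⊑ whole G
  ⊑-whole {H} = record { V⊆ = λ _ → tt ; E⊆ = Sub.inEAdj H }

  ⊑-addEdge : ∀ H {u v t} (edge : adj u v ≡ just t) → H ⊑ addEdge G S H u v t edge
  ⊑-addEdge H edge = record { V⊆ = inj₁ ; E⊆ = inj₁ }

  module _ {H H′ : Sub G} (H⊑H′ : H ⊑ H′) where

    TPath-mono : ∀ {s w a} → TPath G H s w a → TPath G H′ s w a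
    TPath-mono (here s∈) = here (V⊆ H⊑H′ s∈)
    TPath-mono (step {a = a} {t = t} p (e , q) b) =
      step (TPath-mono p) (E⊆ H⊑H′ e , q) (ArrLT⇒Before H′ a {t} (Before⇒ArrLT H a b))

    Reaches-mono : ∀ {s w} → Reaches G H s w → Reaches G H′ s w
    Reaches-mono = map₂ TPath-mono

    Connected-mono : ∀ {a b} → Connected G H a b → Connected G H′ a b
    Connected-mono (a∈ , st) = V⊆ H⊑H′ a∈ , gmap (λ x → x) (E⊆ H⊑H′) st

  module _ {H : Sub G} where

    TPath-end : ∀ {s w a} → TPath G H s w a → Sub.inV H w
    TPath-end (here s∈)          = s∈
    TPath-end (step _ (e , _) _) = proj₂ (Sub.inEV H e)

    TPath⇒Star : ∀ {s w a} → TPath G H s w a → Star (Adj G H) s w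
    TPath⇒Star (here _)           = ε
    TPath⇒Star (step p (e , _) _) = TPath⇒Star p ◅◅ e ◅ ε

    Star-sym : ∀ {a b} → Star (Adj G H) a b → Star (Adj G H) b a
    Star-sym = reverse (Sub.inESym H)

    reaches-connected : IsIncreasingTemporalForest G S H →
                        ∀ {s w} → s ∈ S → Star (Adj G H) s w → Reaches G H s w
    reaches-connected (_ , _ , sources) s∈ st with sources _ s∈
    ... | r , r∈ , reach with reach r (r∈ , ε)
    ...   | _ , s→r = reach _ (r∈ , Star-sym (TPath⇒Star s→r) ◅◅ st)

  record ExitEdge (H : Sub G) (s : Fin n) (a : Maybe L) : Set where
    field
      from to : Fin n
      label   : L
      arrival : Maybe L
      from∈   : Sub.inV H from
      to∉     : ¬ Sub.inV H to
      edge    : adj from to ≡ just label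
      path    : TPath G (whole G) s from arrival
      in-time : ArrLT arrival label
      label≤  : ArrLE G (just label) a

  exit-edge : ∀ {H} → (∀ w → Dec (Sub.inV H w)) →
              ∀ {s x a} → TPath G (whole G) s x a → Sub.inV H s → ¬ Sub.inV H x → ExitEdge H s a
  exit-edge V? (here _) s∈ x∉ = ⊥-elim (x∉ s∈)
  exit-edge {H} V? (step {w = w} {a = a} {t = t} p (_ , q) b) s∈ x∉ with V? w
  ... | yes w∈ = record
    { from∈ = w∈ ; to∉ = x∉ ; edge = q ; path = p
    ; in-time = Before⇒ArrLT (whole G) a {t} b ; label≤ = inj₂ refl
    }
  ... | no w∉ = let e = exit-edge V? p s∈ w∉ in record
    { ExitEdge {H} e hiding (label≤)
    ; label≤ = inj₁ (ArrLE-ArrLT-trans (ExitEdge.label≤ e) (Before⇒ArrLT (whole G) a {t} b))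
    }

  module Pendant (H : Sub G) {u v : Fin n} {t : L} (edge : adj u v ≡ just t)
                 (u∈ : Sub.inV H u) (v∉ : ¬ Sub.inV H v) where

    H⁺ : Sub G
    H⁺ = addEdge G S H u v t edge

    ⊑⁺ : H ⊑ H⁺
    ⊑⁺ = ⊑-addEdge H edge

    u≢v : u ≢ v
    u≢v refl = v∉ u∈

    neighbour≡u : ∀ {a} → Adj G H⁺ a v → a ≡ u
    neighbour≡u (inj₁ e)                    = ⊥-elim (v∉ (proj₂ (Sub.inEV H e)))
    neighbour≡u (inj₂ (inj₁ (a≡u , _)))     = a≡u
    neighbour≡u (inj₂ (inj₂ (refl , v≡u))) = ⊥-elim (u≢v (sym v≡u))

    neighbour≡u′ : ∀ {a} → Adj G H⁺ v a → a ≡ u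
    neighbour≡u′ = neighbour≡u ∘ Sub.inESym H⁺

    extend : ∀ {s a} → TPath G H s u a → ArrLT a t → TPath G H⁺ s v (just t)
    extend {a = a} p a<t =
      step (TPath-mono ⊑⁺ p) (inj₂ (inj₁ (refl , refl)) , edge) (ArrLT⇒Before H⁺ a a<t)

    data SplitPath (s : Fin n) : Fin n → Maybe L → Set where
      old : ∀ {x a} → x ≢ v → TPath G H s x a → SplitPath s x a
      new : ∀ {a} → TPath G H s u a → ArrLT a t → SplitPath s v (just t)

    label≡t : ∀ {t′} → adj u v ≡ just t′ → t′ ≡ t
    label≡t q = just-injective (trans (sym q) edge)

    split-path : ∀ {s x a} → Sub.inV H s → TPath G H⁺ s x a → SplitPath s x a
    split-path s∈ (here _) = old (λ { refl → v∉ s∈ }) (here s∈)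
    split-path s∈ (step {a = a} {t = t′} p (e , q) b) with split-path s∈ p | e
    ... | old _ p′  | inj₁ e′ =
      old (λ { refl → v∉ (proj₂ (Sub.inEV H e′)) })
          (step p′ (e′ , q) (ArrLT⇒Before H a {t′} (Before⇒ArrLT H⁺ a b)))
    ... | old w≢v _ | inj₂ (inj₂ (refl , _)) = ⊥-elim (w≢v refl)
    ... | new _ _   | inj₁ e′                = ⊥-elim (v∉ (proj₁ (Sub.inEV H e′)))
    ... | new _ _   | inj₂ (inj₁ (v≡u , _))  = ⊥-elim (u≢v (sym v≡u))
    ... | new _ _   | inj₂ (inj₂ (_ , refl)) =
      ⊥-elim (<-irrefl (sym (label≡t (trans (adjSym u v) q))) b)
    ... | old _ p′  | inj₂ (inj₁ (refl , refl)) with label≡t q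
    ...   | refl = new p′ (Before⇒ArrLT H⁺ a b)

    data SplitStar (x : Fin n) : Fin n → Set where
      old : ∀ {w} → Sub.inV H w → Star (Adj G H) x w → SplitStar x w
      new : Star (Adj G H) x u → SplitStar x v

    split-star : ∀ {x w} → Sub.inV H x → Star (Adj G H⁺) x w → SplitStar x w
    split-star {x} x∈ = go (old x∈ ε)
      where
        extend-split : ∀ {a b} → SplitStar x a → Adj G H⁺ a b → SplitStar x b
        extend-split (old _ st) (inj₁ e)                    = old (proj₂ (Sub.inEV H e)) (st ◅◅ e ◅ ε)
        extend-split (old _ st) (inj₂ (inj₁ (refl , refl))) = new st
        extend-split (old a∈ _) (inj₂ (inj₂ (refl , refl))) = ⊥-elim (v∉ a∈)
        extend-split (new _)    (inj₁ e)                    = ⊥-elim (v∉ (proj₁ (Sub.inEV H e)))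
        extend-split (new _)    (inj₂ (inj₁ (v≡u , _)))     = ⊥-elim (u≢v (sym v≡u))
        extend-split (new st)   (inj₂ (inj₂ (_ , refl)))    = old u∈ st

        go : ∀ {a w} → SplitStar x a → Star (Adj G H⁺) a w → SplitStar x w
        go acc ε        = acc
        go acc (e ◅ st) = go (extend-split acc e) st

    connected⁻ : ∀ {a b} → Sub.inV H a → Sub.inV H b → Connected G H⁺ a b → Connected G H a b
    connected⁻ a∈ b∈ (_ , st) with split-star a∈ st
    ... | old _ st′ = a∈ , st′
    ... | new _     = ⊥-elim (v∉ b∈)

    components⁺ : ∀ {c} → HasComponents G H c → HasComponents G H⁺ c
    components⁺ (reps , len , reps∈ , apart , cover) =
      reps , len , All.map inj₁ reps∈ ,
      AllPairs-restrict (λ a∈ b∈ ¬conn conn → ¬conn (connected⁻ a∈ b∈ conn)) reps∈ apart ,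
      cover⁺
      where
        cover⁺ : ∀ w → Sub.inV H⁺ w → ∃ λ r → r ∈ₗ reps × Connected G H⁺ r w
        cover⁺ w (inj₁ w∈)          = map₂ (map₂ (Connected-mono ⊑⁺)) (cover w w∈)
        cover⁺ _ (inj₂ (inj₁ refl)) = map₂ (map₂ (Connected-mono ⊑⁺)) (cover u u∈)
        cover⁺ _ (inj₂ (inj₂ refl)) with Connected-mono ⊑⁺ (proj₂ (proj₂ (cover u u∈)))
        ... | r∈ , st = _ , proj₁ (proj₂ (cover u u∈)) , r∈ , st ◅◅ inj₂ (inj₁ (refl , refl)) ◅ ε

    edge⁻ : ∀ {a b} → v ≢ a → v ≢ b → Adj G H⁺ a b → Adj G H a b
    edge⁻ _   _   (inj₁ e)                = e
    edge⁻ _   v≢b (inj₂ (inj₁ (_ , b≡v))) = ⊥-elim (v≢b (sym b≡v))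
    edge⁻ v≢a _   (inj₂ (inj₂ (a≡v , _))) = ⊥-elim (v≢a (sym a≡v))

    restrict-cycle : (c : Cycle G H⁺) → All (v ≢_) (Cycle.vs c) → Cycle G H
    restrict-cycle record { long = long ; uniq = uniq ; linked = linked
                          ; closing = x , y , _ , refl , ws , refl , y~x } avoid = record
      { vs = x ∷ ws ++ [ y ] ; long = long ; uniq = uniq
      ; linked  = Linked-restrict edge⁻ avoid linked
      ; closing = x , y , _ , refl , ws , refl ,
                  edge⁻ (All.lookup avoid (there (∈-++⁺ʳ ws (here refl))))
                        (All.lookup avoid (here refl)) y~x
      }

    v∉cycle : (c : Cycle G H⁺) → ¬ v ∈ₗ Cycle.vs c
    v∉cycle record { long = s≤s (s≤s ()) ; closing = _ , _ , _ , refl , [] , refl , _ }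
    v∉cycle record { uniq = uniq ; linked = linked
                   ; closing = x , y , _ , refl , z ∷ ws , refl , y~x } v∈
      with Linked-end neighbour≡u neighbour≡u′ linked uniq v∈
    v∉cycle record { uniq = _ ∷ z∉ ∷ _ ; linked = v~z ∷ _
                   ; closing = _ , y , _ , refl , z ∷ ws , refl , y~v } _
      | inj₁ (_ , refl) =
      All.lookup z∉ (∈-++⁺ʳ ws (here refl)) (trans (neighbour≡u′ v~z) (sym (neighbour≡u y~v)))
    v∉cycle record { uniq = x∉ ∷ _ ; linked = _ ∷ linked′
                   ; closing = x , y , _ , refl , z ∷ ws , refl , y~x } _
      | inj₂ v-last with Last-unique v-last (Last-++ (x ∷ z ∷ ws) y)
    ... | refl with predecessor (Last-++ ws v) linked′
    ...   | p , p∈ , p~v = All.lookup x∉ p∈ (trans (neighbour≡u′ y~x) (sym (neighbour≡u p~v)))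

    acyclic⁺ : IsForest G H → IsForest G H⁺
    acyclic⁺ acyclic c with v ∈ₗ? Cycle.vs c
    ... | yes v∈ = v∉cycle c v∈
    ... | no  v∉ = acyclic (restrict-cycle c (¬Any⇒All¬ _ v∉))

  record Invariant (H : Sub G) : Set where
    field
      S⊆V            : ∀ {s} → s ∈ S → Sub.inV H s
      reached        : ∀ {w} → Sub.inV H w → ∃ λ s → s ∈ S × Reaches G H s w
      arrival-unique : ∀ {s s′ w a a′} → s ∈ S → s′ ∈ S →
                       TPath G H s w a → TPath G H s′ w a′ → a ≡ a′
      foremost       : ∀ v → Sub.inV H v → v ∉ S →
                       ∀ u a → u ∈ S → TPath G H u v a → IsForemostArrival G S v a
      V?             : ∀ w → Dec (Sub.inV H w)
      increasing     : IsIncreasingTemporalForest G S H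

  ReachedBefore : Sub G → Fin n → L → Set
  ReachedBefore H u t = ∃ λ s → s ∈ S × ∃ λ a → TPath G H s u a × ArrLT a t

  module _ {H : Sub G} (I : Invariant H) where
    open Invariant I

    ext-intro : ∀ {u v t} → Sub.inV H u → ¬ Sub.inV H v → (edge : adj u v ≡ just t) →
                ReachedBefore H u t → InExt G S H u v t
    ext-intro u∈ v∉ edge (s , s∈ , a , p , a<t) =
      u∈ , v∉ , edge ,
      acyclic⁺ (proj₁ increasing) , components⁺ (proj₁ (proj₂ increasing)) , sources⁺
      where
        open Pendant H edge u∈ v∉

        -- v is reached in time from every source, since all sources reach u at the same time.
        reach : ∀ {s′} → s′ ∈ S → ∀ w → Connected G H⁺ s′ w → Reaches G H⁺ s′ w
        reach s′∈ w (_ , st) with split-star (S⊆V s′∈) st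
        ... | old _ st′ = Reaches-mono ⊑⁺ (reaches-connected increasing s′∈ st′)
        ... | new st′ with reaches-connected increasing s′∈ st′
        ...   | _ , p′ =
          just _ , extend p′ (subst (λ b → ArrLT b _) (arrival-unique s∈ s′∈ p p′) a<t)

        sources⁺ : ∀ s′ → s′ ∈ S →
                   ∃ λ r → Sub.inV H⁺ r × (∀ w → Connected G H⁺ r w → Reaches G H⁺ s′ w)
        sources⁺ s′ s′∈ = s′ , inj₁ (S⊆V s′∈) , reach s′∈

    ext-elim : ∀ {u v t} → InExt G S H u v t → ReachedBefore H u t
    ext-elim {u} {v} {t} (u∈ , v∉ , edge , increasing⁺) = through-u (reached u∈)
      where
        open Pendant H edge u∈ v∉

        -- H⁺ is an increasing forest, so a source reaching u also reaches v, and only via u.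
        through-u : (∃ λ s → s ∈ S × Reaches G H s u) → ReachedBefore H u t
        through-u (s , s∈ , _ , p)
          with reaches-connected increasing⁺ s∈
                 (TPath⇒Star (TPath-mono ⊑⁺ p) ◅◅ inj₂ (inj₁ (refl , refl)) ◅ ε)
        ... | _ , p⁺ with split-path (S⊆V s∈) p⁺
        ...   | old v≢v _ = ⊥-elim (v≢v refl)
        ...   | new q a<t = s , s∈ , _ , q , a<t

    foremost-reachedBefore : ∀ {y s a t} → Sub.inV H y → s ∈ S →
                             TPath G (whole G) s y a → ArrLT a t → ReachedBefore H y t
    foremost-reachedBefore {y} y∈ s∈ p a<t with y ∈S? S
    ... | yes y∈S = y , y∈S , nothing , here y∈ , tt
    ... | no  y∉S with reached y∈
    ...   | s′ , s′∈ , a′ , p′ =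
      s′ , s′∈ , a′ , p′ , ArrLE-ArrLT-trans (foremost y y∈ y∉S s′ a′ s′∈ p′ _ _ s∈ p) a<t

    ext-from-path : ∀ {s x a} → s ∈ S → TPath G (whole G) s x a → ¬ Sub.inV H x →
                    ∃ λ u → ∃ λ v → ∃ λ t → InExt G S H u v t × ArrLE G (just t) a
    ext-from-path s∈ p x∉ =
      from , to , label ,
      ext-intro from∈ to∉ edge (foremost-reachedBefore from∈ s∈ path in-time) ,
      label≤
      where open ExitEdge (exit-edge {H} V? p (S⊆V s∈) x∉)

  module AddMinimal {H : Sub G} (I : Invariant H) {u v t} (ext : InExt G S H u v t)
                    (minimal : ∀ u′ v′ t′ → InExt G S H u′ v′ t′ → t ≤ t′) where
    open Invariant I
    open Pendant H (proj₁ (proj₂ (proj₂ ext))) (proj₁ ext) (proj₁ (proj₂ ext))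

    reached⁺ : ∀ {w} → Sub.inV H⁺ w → ∃ λ s → s ∈ S × Reaches G H⁺ s w
    reached⁺ (inj₁ w∈)          = map₂ (map₂ (Reaches-mono ⊑⁺)) (reached w∈)
    reached⁺ (inj₂ (inj₁ refl)) = map₂ (map₂ (Reaches-mono ⊑⁺)) (reached (proj₁ ext))
    reached⁺ (inj₂ (inj₂ refl)) with ext-elim I ext
    ... | s , s∈ , _ , p , a<t = s , s∈ , just t , extend p a<t

    arrival-unique⁺ : ∀ {s s′ w a a′} → s ∈ S → s′ ∈ S →
                      TPath G H⁺ s w a → TPath G H⁺ s′ w a′ → a ≡ a′
    arrival-unique⁺ s∈ s′∈ p p′ with split-path (S⊆V s∈) p | split-path (S⊆V s′∈) p′
    ... | old _ q   | old _ q′  = arrival-unique s∈ s′∈ q q′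
    ... | old w≢v _ | new _ _   = ⊥-elim (w≢v refl)
    ... | new _ _   | old w≢v _ = ⊥-elim (w≢v refl)
    ... | new _ _   | new _ _   = refl

    -- A path of G to v must leave H through an edge of ext(H), whose label is at least t.
    foremost⁺ : ∀ x → Sub.inV H⁺ x → x ∉ S →
                ∀ s a → s ∈ S → TPath G H⁺ s x a → IsForemostArrival G S x a
    foremost⁺ x _ x∉S s a s∈ p with split-path (S⊆V s∈) p
    ... | old _ q = foremost x (TPath-end q) x∉S s a s∈ q
    ... | new _ _ = λ s′ a′ s′∈ p′ →
      let (u′ , v′ , t′ , ext′ , t′≤a′) = ext-from-path I s′∈ p′ (proj₁ (proj₂ ext))
      in ≤-ArrLE-trans (minimal u′ v′ t′ ext′) t′≤a′

    invariant⁺ : Invariant H⁺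
    invariant⁺ = record
      { S⊆V            = inj₁ ∘ S⊆V
      ; reached        = reached⁺
      ; arrival-unique = arrival-unique⁺
      ; foremost       = foremost⁺
      ; V?             = λ w → V? w ⊎-dec (w ≟ u ⊎-dec w ≟ v)
      ; increasing     = proj₂ (proj₂ (proj₂ ext))
      }

    ext-labels⁺ : ∀ u′ v′ t′ → InExt G S H⁺ u′ v′ t′ → t ≤ t′
    ext-labels⁺ u′ v′ t′ ext′@(_ , v′∉ , edge′ , _) with ext-elim invariant⁺ ext′
    ... | s , s∈ , a , p , a<t′ with split-path (S⊆V s∈) p
    ...   | old _ q =
      minimal u′ v′ t′ (ext-intro I (TPath-end q) (v′∉ ∘ inj₁) edge′ (s , s∈ , a , q , a<t′))
    ...   | new _ _ = inj₁ a<t′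

  initial-star : ∀ {a b} → Star (Adj G (initial G S)) a b → a ≡ b
  initial-star ε = refl

  initial-arrival : ∀ {s w a} → TPath G (initial G S) s w a → a ≡ nothing
  initial-arrival (here _) = refl

  initial-acyclic : IsForest G (initial G S)
  initial-acyclic record { linked = () ∷ _ }
  initial-acyclic record { linked = [] ; long = () }
  initial-acyclic record { linked = [-] ; long = s≤s () }

  initial-invariant : Invariant (initial G S)
  initial-invariant = record
    { S⊆V            = λ s∈ → s∈
    ; reached        = λ w∈ → _ , w∈ , nothing , here w∈
    ; arrival-unique = λ _ _ p p′ → trans (initial-arrival p) (sym (initial-arrival p′))
    ; foremost       = λ v v∈ v∉ → ⊥-elim (v∉ v∈)
    ; V?             = _∈S? S
    ; increasing     = initial-acyclic , components , sources
    }
    where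
      open Enumeration (enumerate S)
      components : HasComponents G (initial G S) ∣ S ∣
      components = elements , length≡ , sound ,
                   AllPairs.map (λ a≢b conn → a≢b (initial-star (proj₂ conn))) unique ,
                   λ w w∈ → w , complete w∈ , w∈ , ε
      sources : ∀ s → s ∈ S →
                ∃ λ r → r ∈ S × (∀ w → Connected G (initial G S) r w → Reaches G (initial G S) s w)
      sources s s∈ = s , s∈ , λ
        { _ (_ , st) → subst (Reaches G (initial G S) s) (initial-star st) (nothing , here s∈) }

  LabelsBelowExt : Sub G → List L → Set
  LabelsBelowExt H ls = All (λ l → ∀ u v t → InExt G S H u v t → l ≤ t) ls

  run-invariant : ∀ {H ls} → Run G S H ls → Invariant H × Linked _≤_ ls × LabelsBelowExt H ls
  run-invariant start = initial-invariant , [] , []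
  run-invariant (add run u v t ext minimal) with run-invariant run
  ... | I , sorted , below =
    invariant⁺ ,
    Linked-∷ʳ sorted (All.map (λ l≤ → l≤ u v t ext) below) ,
    ∷ʳ⁺ (All.map (λ l≤ u′ v′ t′ ext′ → ≤-trans (l≤ u v t ext) (ext-labels⁺ u′ v′ t′ ext′)) below)
        ext-labels⁺
    where open AddMinimal I ext minimal

  foremost-forest : ∀ {H} → Invariant H → ExtEmpty G S H → IsForemostForest G S H
  foremost-forest {H} I closed = (increasing , foremost) , reached-from-S , reachable⇒in-V
    where
      open Invariant I
      reached-from-S : ∀ v → Sub.inV H v → ∃ λ s → s ∈ S × Reaches G (whole G) s v
      reached-from-S v v∈ = map₂ (map₂ (Reaches-mono ⊑-whole)) (reached v∈)

      reachable⇒in-V : ∀ v s → s ∈ S → Reaches G (whole G) s v → Sub.inV H v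
      reachable⇒in-V v s s∈ (_ , p) with V? v
      ... | yes v∈ = v∈
      ... | no  v∉ =
        let (u′ , v′ , t′ , ext , _) = ext-from-path I s∈ p v∉ in ⊥-elim (closed u′ v′ t′ ext)

lemma3p3 : (O : Labels) (n : ℕ) (G : TemporalGraph O n) (S : Subset n)
           (H : Sub G) (ls : List (Labels.L O)) →
           Run G S H ls → ExtEmpty G S H →
           IsForemostForest G S H × Linked (Labels._≤_ O) ls
lemma3p3 O n G S H ls run closed with ForemostForest.run-invariant G S run
... | invariant , sorted , _ = ForemostForest.foremost-forest G S invariant closed , sorted
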